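{- Let $S \in \mathbb{Z}^{m \times m}$ be a nonsingular matrix in Smith normal form, let $F \in \mathbb{Z}^{n \times m}$, and let $H$ be the Hermite basis of the integer relations lattice $\mathcal{R}(S,F)$. Fix a partition $n = n_1 + n_2$ and write $H = \begin{bmatrix} \bar{H}_1 & H_{12} \\ 0 & \bar{H}_2 \end{bmatrix}$ with $\bar{H}_1$ of dimension $n_1 \times n_1$, so that $H = H_2 H_1$ where $H_2 = \begin{bmatrix} I_{n_1} & H_{12} \\ 0 & \bar{H}_2 \end{bmatrix}$ and $H_1 = \begin{bmatrix} \bar{H}_1 & 0 \\ 0 & I_{n_2} \end{bmatrix}$. Decompose $F = \begin{bmatrix} \bar{F} \\ A \end{bmatrix}$, where $A$ consists of the last $n_2$ rows of $F$. Then $H_1$ is the Hermite basis of $$\mathcal{R}\left( \begin{bmatrix} S \\ A \end{bmatrix}, F \right).$$ Furthermore, if the inputs to $\mathcal{R}(S,F)$ are coprime, then the inputs $\begin{bmatrix} S \\ A \end{bmatrix}$ and $F$ of this lattice are also coprime.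
   Context: For $M \in \mathbb{Z}^{\ell \times m}$ of full column rank and $F \in \mathbb{Z}^{n \times m}$, the integer relations lattice is $\mathcal{R}(M,F) := \{ p \in \mathbb{Z}^{1 \times n} \mid pF = QM \text{ for some integer matrix } Q\}$. Its Hermite basis is the unique nonsingular $n \times n$ basis of this lattice in (upper triangular, row) Hermite normal form. Inputs $M$ and $F$ are coprime if the Hermite basis of the lattice generated by the rows of $M$ and the rows of $F$ is the identity. -}

module Defs where

open import Data.Nat using (ℕ; zero; suc)
open import Data.Fin using (Fin; zero; suc; _<_; _≤_; _↑ˡ_; _↑ʳ_; splitAt)
open import Data.Sum using (_⊎_; inj₁; inj₂)
open import Data.Integer using (ℤ; +_; _+_; _*_) renaming (_<_ to _<ℤ_; _≤_ to _≤ℤ_)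
open import Data.Integer.Divisibility using () renaming (_∣_ to _∣ℤ_)
open import Data.Product using (Σ; _×_; ∃)
open import Relation.Binary.PropositionalEquality using (_≡_; _≢_)
open import Function.Bundles using (_⇔_)

Mat : ℕ → ℕ → Set
Mat r c = Fin r → Fin c → ℤ

RowVec : ℕ → Set
RowVec n = Fin n → ℤ

∑ : {n : ℕ} → (Fin n → ℤ) → ℤ
∑ {zero}  f = + 0
∑ {suc n} f = f zero + ∑ (λ i → f (suc i))

_·ᵥ_ : {r c : ℕ} → RowVec r → Mat r c → RowVec c
(x ·ᵥ M) j = ∑ (λ i → x i * M i j)

_≋_ : {n : ℕ} → RowVec n → RowVec n → Set
p ≋ q = ∀ j → p j ≡ q j

Lattice : ℕ → Set₁
Lattice n = RowVec n → Set

Relations : {ℓ m n : ℕ} → Mat ℓ m → Mat n m → Lattice n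
Relations {ℓ} M F p = Σ (RowVec ℓ) (λ Q → (p ·ᵥ F) ≋ (Q ·ᵥ M))

Generated : {ℓ m n : ℕ} → Mat ℓ m → Mat n m → Lattice m
Generated {ℓ} {m} {n} M F p =
  Σ (RowVec ℓ) (λ x → Σ (RowVec n) (λ y → ∀ j → p j ≡ (x ·ᵥ M) j + (y ·ᵥ F) j))

IsHermite : {n : ℕ} → Mat n n → Set
IsHermite {n} H =
  (∀ (i j : Fin n) → j < i → H i j ≡ + 0) ×
  (∀ (i : Fin n) → + 0 <ℤ H i i) ×
  (∀ (i j : Fin n) → i < j → (+ 0 ≤ℤ H i j) × (H i j <ℤ H j j))

IsBasisOf : {n : ℕ} → Mat n n → Lattice n → Set
IsBasisOf {n} H L = ∀ (p : RowVec n) → L p ⇔ Σ (RowVec n) (λ x → p ≋ (x ·ᵥ H))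

IsHermiteBasisOf : {n : ℕ} → Mat n n → Lattice n → Set
IsHermiteBasisOf H L = IsHermite H × IsBasisOf H L

idMat : {n : ℕ} → Mat n n
idMat zero    zero    = + 1
idMat zero    (suc j) = + 0
idMat (suc i) zero    = + 0
idMat (suc i) (suc j) = idMat i j

Coprime : {ℓ m n : ℕ} → Mat ℓ m → Mat n m → Set
Coprime M F = IsHermiteBasisOf idMat (Generated M F)

IsNonsingularSmith : {m : ℕ} → Mat m m → Set
IsNonsingularSmith {m} S =
  (∀ (i j : Fin m) → i ≢ j → S i j ≡ + 0) ×
  (∀ (i : Fin m) → + 0 <ℤ S i i) ×
  (∀ (i j : Fin m) → i ≤ j → S i i ∣ℤ S j j)

stack : {ℓ k m : ℕ} → Mat ℓ m → Mat k m → Mat (ℓ Data.Nat.+ k) m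
stack {ℓ} M A i j with splitAt ℓ i
... | inj₁ i' = M i' j
... | inj₂ i' = A i' j

lastRows : (n₁ n₂ : ℕ) {m : ℕ} → Mat (n₁ Data.Nat.+ n₂) m → Mat n₂ m
lastRows n₁ n₂ F i j = F (n₁ ↑ʳ i) j

blockH1 : (n₁ n₂ : ℕ) → Mat (n₁ Data.Nat.+ n₂) (n₁ Data.Nat.+ n₂) → Mat (n₁ Data.Nat.+ n₂) (n₁ Data.Nat.+ n₂)
blockH1 n₁ n₂ H i j with splitAt n₁ i | splitAt n₁ j
... | inj₁ i' | inj₁ j' = H (i' ↑ˡ n₂) (j' ↑ˡ n₂)
... | inj₁ i' | inj₂ j' = + 0
... | inj₂ i' | inj₁ j' = + 0
... | inj₂ i' | inj₂ j' = idMat i' j'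

{-# OPTIONS --safe #-}
module Submission where

-- A relation of [S ; A] with F is a relation of S with F up to a combination
-- of the last n₂ rows of F, so R([S ; A], F) = R(S, F) + (0 × ℤ^{n₂}).  As H
-- is upper triangular, the first n₁ coordinates of a vector x H depend only
-- on the first n₁ coordinates of x, through H̄₁; freeing the last n₂
-- coordinates therefore turns the Hermite basis H into H₁.  Coprimality is
-- inherited because adding rows to S only enlarges the lattice generated
-- together with F, which was already all of ℤ^m.

open import Defs
open import Data.Nat using (ℕ; zero; suc; _+_; z≤n; s≤s)
open import Data.Product using (Σ; _×_; _,_)
open import Data.Fin using (Fin; zero; suc; _↑ˡ_; _↑ʳ_; _<_)
open import Data.Fin.Properties using (splitAt-↑ˡ; splitAt-↑ʳ; <⇒≢)
open import Data.Vec.Functional using (_++_; take; drop)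
open import Data.Vec.Functional.Properties using (lookup-++ˡ; lookup-++ʳ)
open import Data.Integer using (ℤ; +_; -_; _-_; +<+)
  renaming (_+_ to _+ℤ_; _*_ to _*ℤ_; _<_ to _<ℤ_; _≤_ to _≤ℤ_)
import Data.Integer.Properties as ℤ
open import Data.Integer.Solver using (module +-*-Solver)
open import Algebra.Properties.CommutativeSemigroup ℤ.+-commutativeSemigroup using (interchange)
open import Algebra.Properties.Ring ℤ.+-*-ring using ([y-z]x≈yx-zx)
open import Function.Base using (_∘_)
open import Relation.Nullary using (contradiction)
open import Function.Bundles using (_⇔_; mk⇔; Equivalence)
import Function.Properties.Equivalence as ⇔
open import Relation.Binary.PropositionalEquality
  using (_≡_; _≢_; refl; sym; trans; cong; cong₂; module ≡-Reasoning)

open +-*-Solver using (solve; _:+_; _:-_; _:=_)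

data Split (a b : ℕ) : Fin (a + b) → Set where
  left  : (i : Fin a) → Split a b (i ↑ˡ b)
  right : (i : Fin b) → Split a b (a ↑ʳ i)

split : ∀ a b (i : Fin (a + b)) → Split a b i
split zero    b i       = right i
split (suc a) b zero    = left zero
split (suc a) b (suc i) with split a b i
... | left k  = left (suc k)
... | right k = right k

≋-split : ∀ {a b} {u v : RowVec (a + b)} →
  take a u ≋ take a v → drop a u ≋ drop a v → u ≋ v
≋-split {a} {b} u≋vˡ u≋vʳ j with split a b j
... | left i  = u≋vˡ i
... | right i = u≋vʳ i

↑ˡ<↑ʳ : ∀ {a b} (i : Fin a) (j : Fin b) → i ↑ˡ b < a ↑ʳ j
↑ˡ<↑ʳ zero    j = s≤s z≤n
↑ˡ<↑ʳ (suc i) j = s≤s (↑ˡ<↑ʳ i j)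

∑-cong : ∀ {n} {f g : Fin n → ℤ} → (∀ i → f i ≡ g i) → ∑ f ≡ ∑ g
∑-cong {zero}  f≡g = refl
∑-cong {suc n} f≡g = cong₂ _+ℤ_ (f≡g zero) (∑-cong (f≡g ∘ suc))

∑-zero : ∀ {n} {f : Fin n → ℤ} → (∀ i → f i ≡ + 0) → ∑ f ≡ + 0
∑-zero {zero}  f≡0 = refl
∑-zero {suc n} f≡0 = cong₂ _+ℤ_ (f≡0 zero) (∑-zero (f≡0 ∘ suc))

∑-distrib-+ : ∀ {n} (f g : Fin n → ℤ) → ∑ (λ i → f i +ℤ g i) ≡ ∑ f +ℤ ∑ g
∑-distrib-+ {zero}  f g = refl
∑-distrib-+ {suc n} f g =
  trans (cong (f zero +ℤ g zero +ℤ_) (∑-distrib-+ (f ∘ suc) (g ∘ suc)))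
        (interchange (f zero) (g zero) (∑ (f ∘ suc)) (∑ (g ∘ suc)))

∑-neg : ∀ {n} (f : Fin n → ℤ) → ∑ (λ i → - f i) ≡ - ∑ f
∑-neg {zero}  f = refl
∑-neg {suc n} f =
  trans (cong (- f zero +ℤ_) (∑-neg (f ∘ suc))) (sym (ℤ.neg-distrib-+ (f zero) (∑ (f ∘ suc))))

∑-distrib-- : ∀ {n} (f g : Fin n → ℤ) → ∑ (λ i → f i - g i) ≡ ∑ f - ∑ g
∑-distrib-- f g = trans (∑-distrib-+ f (-_ ∘ g)) (cong (∑ f +ℤ_) (∑-neg g))

∑-++ : ∀ a {b} (f : Fin (a + b) → ℤ) → ∑ f ≡ ∑ (take a f) +ℤ ∑ (drop a f)
∑-++ zero    f = sym (ℤ.+-identityˡ (∑ f))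
∑-++ (suc a) f =
  trans (cong (f zero +ℤ_) (∑-++ a (f ∘ suc)))
        (sym (ℤ.+-assoc (f zero) (∑ (take a (f ∘ suc))) (∑ (drop a (f ∘ suc)))))

·ᵥ-congˡ : ∀ {r c} {x y : RowVec r} (M : Mat r c) → x ≋ y → (x ·ᵥ M) ≋ (y ·ᵥ M)
·ᵥ-congˡ M x≋y j = ∑-cong (λ i → cong (_*ℤ M i j) (x≋y i))

·ᵥ-congʳ : ∀ {r c d} (x : RowVec r) (M : Mat r c) (N : Mat r d) j k →
  (∀ i → M i j ≡ N i k) → (x ·ᵥ M) j ≡ (x ·ᵥ N) k
·ᵥ-congʳ x M N j k M≡N = ∑-cong (λ i → cong (x i *ℤ_) (M≡N i))

·ᵥ-zeroˡ : ∀ {r c} {x : RowVec r} (M : Mat r c) j → (∀ i → x i ≡ + 0) → (x ·ᵥ M) j ≡ + 0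
·ᵥ-zeroˡ M j x≡0 = ∑-zero (λ i → trans (cong (_*ℤ M i j) (x≡0 i)) (ℤ.*-zeroˡ (M i j)))

·ᵥ-zeroʳ : ∀ {r c} (x : RowVec r) (M : Mat r c) j → (∀ i → M i j ≡ + 0) → (x ·ᵥ M) j ≡ + 0
·ᵥ-zeroʳ x M j M≡0 = ∑-zero (λ i → trans (cong (x i *ℤ_) (M≡0 i)) (ℤ.*-zeroʳ (x i)))

·ᵥ-distrib-+ : ∀ {r c} (u v : RowVec r) (M : Mat r c) j →
  ((λ i → u i +ℤ v i) ·ᵥ M) j ≡ (u ·ᵥ M) j +ℤ (v ·ᵥ M) j
·ᵥ-distrib-+ u v M j =
  trans (∑-cong (λ i → ℤ.*-distribʳ-+ (M i j) (u i) (v i)))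
        (∑-distrib-+ (λ i → u i *ℤ M i j) (λ i → v i *ℤ M i j))

·ᵥ-distrib-- : ∀ {r c} (u v : RowVec r) (M : Mat r c) j →
  ((λ i → u i - v i) ·ᵥ M) j ≡ (u ·ᵥ M) j - (v ·ᵥ M) j
·ᵥ-distrib-- u v M j =
  trans (∑-cong (λ i → [y-z]x≈yx-zx (M i j) (u i) (v i)))
        (∑-distrib-- (λ i → u i *ℤ M i j) (λ i → v i *ℤ M i j))

·ᵥ-idMat : ∀ {n} (x : RowVec n) → (x ·ᵥ idMat) ≋ x
·ᵥ-idMat {suc n} x zero =
  trans (cong₂ _+ℤ_ (ℤ.*-identityʳ (x zero)) (·ᵥ-zeroʳ (x ∘ suc) (idMat ∘ suc) zero (λ _ → refl)))
        (ℤ.+-identityʳ (x zero))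
·ᵥ-idMat {suc n} x (suc j) =
  trans (cong₂ _+ℤ_ (ℤ.*-zeroʳ (x zero)) (·ᵥ-idMat (x ∘ suc) j)) (ℤ.+-identityˡ (x (suc j)))

·ᵥ-split : ∀ a {b c} (x : RowVec (a + b)) (M : Mat (a + b) c) j →
  (x ·ᵥ M) j ≡ (take a x ·ᵥ take a M) j +ℤ (drop a x ·ᵥ drop a M) j
·ᵥ-split a x M j = ∑-++ a (λ i → x i *ℤ M i j)

stack-↑ˡ : ∀ {ℓ k m} (M : Mat ℓ m) (A : Mat k m) i j → stack M A (i ↑ˡ k) j ≡ M i j
stack-↑ˡ {ℓ} {k} M A i j rewrite splitAt-↑ˡ ℓ i k = refl

stack-↑ʳ : ∀ {ℓ k m} (M : Mat ℓ m) (A : Mat k m) i j → stack M A (ℓ ↑ʳ i) j ≡ A i j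
stack-↑ʳ {ℓ} {k} M A i j rewrite splitAt-↑ʳ ℓ k i = refl

·ᵥ-stack : ∀ {ℓ k m} (x : RowVec (ℓ + k)) (M : Mat ℓ m) (A : Mat k m) j →
  (x ·ᵥ stack M A) j ≡ (take ℓ x ·ᵥ M) j +ℤ (drop ℓ x ·ᵥ A) j
·ᵥ-stack {ℓ} x M A j =
  trans (·ᵥ-split ℓ x (stack M A) j)
        (cong₂ _+ℤ_ (·ᵥ-congʳ (take ℓ x) (take ℓ (stack M A)) M j j (λ i → stack-↑ˡ M A i j))
                    (·ᵥ-congʳ (drop ℓ x) (drop ℓ (stack M A)) A j j (λ i → stack-↑ʳ M A i j)))

·ᵥ-++-stack : ∀ {ℓ k m} (x : RowVec ℓ) (y : RowVec k) (M : Mat ℓ m) (A : Mat k m) j →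
  ((x ++ y) ·ᵥ stack M A) j ≡ (x ·ᵥ M) j +ℤ (y ·ᵥ A) j
·ᵥ-++-stack x y M A j =
  trans (·ᵥ-stack (x ++ y) M A j)
        (cong₂ _+ℤ_ (·ᵥ-congˡ M (lookup-++ˡ x y) j) (·ᵥ-congˡ A (lookup-++ʳ x y) j))

·ᵥ-padˡ : ∀ a {b m} (z : RowVec b) (F : Mat (a + b) m) j →
  (((λ _ → + 0) ++ z) ·ᵥ F) j ≡ (z ·ᵥ lastRows a b F) j
·ᵥ-padˡ a z F j =
  trans (·ᵥ-split a ((λ _ → + 0) ++ z) F j)
        (trans (cong₂ _+ℤ_ (·ᵥ-zeroˡ (take a F) j (lookup-++ˡ {m = a} (λ _ → + 0) z))
                           (·ᵥ-congˡ (lastRows a _ F) (lookup-++ʳ {m = a} (λ _ → + 0) z) j))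
               (ℤ.+-identityˡ _))

-- L + (0 × ℤ^{n₂}), encoded as the vectors that agree with a vector of L on
-- their first n₁ coordinates.
FreeOnLast : ∀ n₁ {n₂} → Lattice (n₁ + n₂) → Lattice (n₁ + n₂)
FreeOnLast n₁ {n₂} L p = Σ (RowVec (n₁ + n₂)) (λ q → L q × take n₁ p ≋ take n₁ q)

relations-stack-lastRows : ∀ {ℓ m n₁ n₂} (M : Mat ℓ m) (F : Mat (n₁ + n₂) m) p →
  Relations (stack M (lastRows n₁ n₂ F)) F p ⇔ FreeOnLast n₁ (Relations M F) p
relations-stack-lastRows {ℓ} {n₁ = n₁} {n₂} M F p = mk⇔ to from
  where
  open ≡-Reasoning
  A = lastRows n₁ n₂ F

  padˡ : RowVec n₂ → RowVec (n₁ + n₂)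
  padˡ z = (λ _ → + 0) ++ z

  padˡ-↑ˡ : ∀ z i → padˡ z (i ↑ˡ n₂) ≡ + 0
  padˡ-↑ˡ = lookup-++ˡ {m = n₁} (λ _ → + 0)

  padˡ-↑ʳ : ∀ z i → padˡ z (n₁ ↑ʳ i) ≡ z i
  padˡ-↑ʳ = lookup-++ʳ {m = n₁} (λ _ → + 0)

  to : Relations (stack M A) F p → FreeOnLast n₁ (Relations M F) p
  to (Q , pF≋Q·MA) = q , (take ℓ Q , qF≋QM) , p≋qˡ
    where
    z = drop ℓ Q
    q = λ i → p i - padˡ z i
    qF≋QM : (q ·ᵥ F) ≋ (take ℓ Q ·ᵥ M)
    qF≋QM j = begin
      (q ·ᵥ F) j
        ≡⟨ ·ᵥ-distrib-- p (padˡ z) F j ⟩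
      (p ·ᵥ F) j - (padˡ z ·ᵥ F) j
        ≡⟨ cong₂ _-_ (trans (pF≋Q·MA j) (·ᵥ-stack Q M A j)) (·ᵥ-padˡ n₁ z F j) ⟩
      (take ℓ Q ·ᵥ M) j +ℤ (z ·ᵥ A) j - (z ·ᵥ A) j
        ≡⟨ solve 2 (λ a b → a :+ b :- b := a) refl ((take ℓ Q ·ᵥ M) j) ((z ·ᵥ A) j) ⟩
      (take ℓ Q ·ᵥ M) j ∎
    p≋qˡ : take n₁ p ≋ take n₁ q
    p≋qˡ i = sym (trans (cong (_-_ (p (i ↑ˡ n₂))) (padˡ-↑ˡ z i)) (ℤ.+-identityʳ (p (i ↑ˡ n₂))))

  from : FreeOnLast n₁ (Relations M F) p → Relations (stack M A) F p
  from (q , (Q , qF≋QM) , p≋qˡ) = Q ++ z , pF≋Qz·MA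
    where
    z = λ i → drop n₁ p i - drop n₁ q i
    p≋q+z : p ≋ (λ i → q i +ℤ padˡ z i)
    p≋q+z = ≋-split
      (λ i → trans (p≋qˡ i)
                   (sym (trans (cong (q (i ↑ˡ n₂) +ℤ_) (padˡ-↑ˡ z i)) (ℤ.+-identityʳ (q (i ↑ˡ n₂))))))
      (λ i → trans (solve 2 (λ a b → a := b :+ (a :- b)) refl (p (n₁ ↑ʳ i)) (q (n₁ ↑ʳ i)))
                   (cong (q (n₁ ↑ʳ i) +ℤ_) (sym (padˡ-↑ʳ z i))))
    pF≋Qz·MA : (p ·ᵥ F) ≋ ((Q ++ z) ·ᵥ stack M A)
    pF≋Qz·MA j = begin
      (p ·ᵥ F) j
        ≡⟨ ·ᵥ-congˡ F p≋q+z j ⟩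
      ((λ i → q i +ℤ padˡ z i) ·ᵥ F) j
        ≡⟨ ·ᵥ-distrib-+ q (padˡ z) F j ⟩
      (q ·ᵥ F) j +ℤ (padˡ z ·ᵥ F) j
        ≡⟨ cong₂ _+ℤ_ (qF≋QM j) (·ᵥ-padˡ n₁ z F j) ⟩
      (Q ·ᵥ M) j +ℤ (z ·ᵥ A) j
        ≡⟨ ·ᵥ-++-stack Q z M A j ⟨
      ((Q ++ z) ·ᵥ stack M A) j ∎

leading : ∀ n₁ {n₂} → Mat (n₁ + n₂) (n₁ + n₂) → Mat n₁ n₁
leading n₁ {n₂} H i j = H (i ↑ˡ n₂) (j ↑ˡ n₂)

IsBlockUpper : ∀ n₁ n₂ → Mat (n₁ + n₂) (n₁ + n₂) → Set
IsBlockUpper n₁ n₂ H = ∀ i j → H (n₁ ↑ʳ i) (j ↑ˡ n₂) ≡ + 0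

isHermite⇒isBlockUpper : ∀ n₁ n₂ {H} → IsHermite H → IsBlockUpper n₁ n₂ H
isHermite⇒isBlockUpper n₁ n₂ (lowerH , _) i j = lowerH (n₁ ↑ʳ i) (j ↑ˡ n₂) (↑ˡ<↑ʳ j i)

take-·ᵥ-blockUpper : ∀ n₁ {n₂} H → IsBlockUpper n₁ n₂ H → (x : RowVec (n₁ + n₂)) →
  take n₁ (x ·ᵥ H) ≋ (take n₁ x ·ᵥ leading n₁ H)
take-·ᵥ-blockUpper n₁ {n₂} H upper x j =
  trans (·ᵥ-split n₁ x H (j ↑ˡ n₂))
        (trans (cong ((take n₁ x ·ᵥ leading n₁ H) j +ℤ_)
                     (·ᵥ-zeroʳ (drop n₁ x) (drop n₁ H) (j ↑ˡ n₂) (λ i → upper i j)))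
               (ℤ.+-identityʳ _))

blockH1-↑ˡ-↑ˡ : ∀ n₁ n₂ H i j → blockH1 n₁ n₂ H (i ↑ˡ n₂) (j ↑ˡ n₂) ≡ H (i ↑ˡ n₂) (j ↑ˡ n₂)
blockH1-↑ˡ-↑ˡ n₁ n₂ H i j rewrite splitAt-↑ˡ n₁ i n₂ | splitAt-↑ˡ n₁ j n₂ = refl

blockH1-↑ˡ-↑ʳ : ∀ n₁ n₂ H i j → blockH1 n₁ n₂ H (i ↑ˡ n₂) (n₁ ↑ʳ j) ≡ + 0
blockH1-↑ˡ-↑ʳ n₁ n₂ H i j rewrite splitAt-↑ˡ n₁ i n₂ | splitAt-↑ʳ n₁ n₂ j = refl

blockH1-↑ʳ-↑ˡ : ∀ n₁ n₂ H i j → blockH1 n₁ n₂ H (n₁ ↑ʳ i) (j ↑ˡ n₂) ≡ + 0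
blockH1-↑ʳ-↑ˡ n₁ n₂ H i j rewrite splitAt-↑ʳ n₁ n₂ i | splitAt-↑ˡ n₁ j n₂ = refl

blockH1-↑ʳ-↑ʳ : ∀ n₁ n₂ H i j → blockH1 n₁ n₂ H (n₁ ↑ʳ i) (n₁ ↑ʳ j) ≡ idMat i j
blockH1-↑ʳ-↑ʳ n₁ n₂ H i j rewrite splitAt-↑ʳ n₁ n₂ i | splitAt-↑ʳ n₁ n₂ j = refl

take-·ᵥ-blockH1 : ∀ n₁ {n₂} H (x : RowVec (n₁ + n₂)) →
  take n₁ (x ·ᵥ blockH1 n₁ n₂ H) ≋ (take n₁ x ·ᵥ leading n₁ H)
take-·ᵥ-blockH1 n₁ {n₂} H x j =
  trans (take-·ᵥ-blockUpper n₁ (blockH1 n₁ n₂ H) (blockH1-↑ʳ-↑ˡ n₁ n₂ H) x j)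
        (·ᵥ-congʳ (take n₁ x) (leading n₁ (blockH1 n₁ n₂ H)) (leading n₁ H) j j
                   (λ i → blockH1-↑ˡ-↑ˡ n₁ n₂ H i j))

drop-·ᵥ-blockH1 : ∀ n₁ {n₂} H (x : RowVec (n₁ + n₂)) →
  drop n₁ (x ·ᵥ blockH1 n₁ n₂ H) ≋ drop n₁ x
drop-·ᵥ-blockH1 n₁ {n₂} H x j = begin
  (x ·ᵥ H₁) (n₁ ↑ʳ j)
    ≡⟨ ·ᵥ-split n₁ x H₁ (n₁ ↑ʳ j) ⟩
  (take n₁ x ·ᵥ take n₁ H₁) (n₁ ↑ʳ j) +ℤ (drop n₁ x ·ᵥ drop n₁ H₁) (n₁ ↑ʳ j)
    ≡⟨ cong₂ _+ℤ_ (·ᵥ-zeroʳ (take n₁ x) (take n₁ H₁) (n₁ ↑ʳ j) (λ i → blockH1-↑ˡ-↑ʳ n₁ n₂ H i j))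
                  (·ᵥ-congʳ (drop n₁ x) (drop n₁ H₁) idMat (n₁ ↑ʳ j) j
                            (λ i → blockH1-↑ʳ-↑ʳ n₁ n₂ H i j)) ⟩
  + 0 +ℤ (drop n₁ x ·ᵥ idMat) j
    ≡⟨ ℤ.+-identityˡ _ ⟩
  (drop n₁ x ·ᵥ idMat) j
    ≡⟨ ·ᵥ-idMat (drop n₁ x) j ⟩
  drop n₁ x j ∎
  where
  open ≡-Reasoning
  H₁ = blockH1 n₁ n₂ H

isBasisOf-freeOnLast : ∀ n₁ n₂ {H} {L : Lattice (n₁ + n₂)} → IsBlockUpper n₁ n₂ H →
  IsBasisOf H L → IsBasisOf (blockH1 n₁ n₂ H) (FreeOnLast n₁ L)
isBasisOf-freeOnLast n₁ n₂ {H} {L} upper basis p = mk⇔ to from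
  where
  open ≡-Reasoning
  H₁ = blockH1 n₁ n₂ H

  to : FreeOnLast n₁ L p → Σ (RowVec (n₁ + n₂)) (λ x → p ≋ (x ·ᵥ H₁))
  to (q , Lq , p≋qˡ) with Equivalence.to (basis q) Lq
  ... | x , q≋xH = x′ , ≋-split p≋x′H₁ˡ p≋x′H₁ʳ
    where
    x′ = take n₁ x ++ drop n₁ p
    p≋x′H₁ˡ : take n₁ p ≋ take n₁ (x′ ·ᵥ H₁)
    p≋x′H₁ˡ j = begin
      p (j ↑ˡ n₂)                    ≡⟨ p≋qˡ j ⟩
      q (j ↑ˡ n₂)                    ≡⟨ q≋xH (j ↑ˡ n₂) ⟩
      (x ·ᵥ H) (j ↑ˡ n₂)             ≡⟨ take-·ᵥ-blockUpper n₁ H upper x j ⟩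
      (take n₁ x ·ᵥ leading n₁ H) j  ≡⟨ ·ᵥ-congˡ (leading n₁ H) (lookup-++ˡ (take n₁ x) (drop n₁ p)) j ⟨
      (take n₁ x′ ·ᵥ leading n₁ H) j ≡⟨ take-·ᵥ-blockH1 n₁ H x′ j ⟨
      (x′ ·ᵥ H₁) (j ↑ˡ n₂)           ∎
    p≋x′H₁ʳ : drop n₁ p ≋ drop n₁ (x′ ·ᵥ H₁)
    p≋x′H₁ʳ j = sym (trans (drop-·ᵥ-blockH1 n₁ H x′ j) (lookup-++ʳ (take n₁ x) (drop n₁ p) j))

  from : Σ (RowVec (n₁ + n₂)) (λ x → p ≋ (x ·ᵥ H₁)) → FreeOnLast n₁ L p
  from (x′ , p≋x′H₁) = x ·ᵥ H , Equivalence.from (basis (x ·ᵥ H)) (x , λ _ → refl) , p≋xHˡ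
    where
    x = take n₁ x′ ++ (λ _ → + 0)
    p≋xHˡ : take n₁ p ≋ take n₁ (x ·ᵥ H)
    p≋xHˡ j = begin
      p (j ↑ˡ n₂)                    ≡⟨ p≋x′H₁ (j ↑ˡ n₂) ⟩
      (x′ ·ᵥ H₁) (j ↑ˡ n₂)           ≡⟨ take-·ᵥ-blockH1 n₁ H x′ j ⟩
      (take n₁ x′ ·ᵥ leading n₁ H) j ≡⟨ ·ᵥ-congˡ (leading n₁ H) (lookup-++ˡ (take n₁ x′) (λ _ → + 0)) j ⟨
      (take n₁ x ·ᵥ leading n₁ H) j  ≡⟨ take-·ᵥ-blockUpper n₁ H upper x j ⟨
      (x ·ᵥ H) (j ↑ˡ n₂)             ∎

isBasisOf-⇔ : ∀ {n} {H : Mat n n} {L L′ : Lattice n} →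
  (∀ p → L p ⇔ L′ p) → IsBasisOf H L′ → IsBasisOf H L
isBasisOf-⇔ L⇔L′ basis p = ⇔.trans (L⇔L′ p) (basis p)

idMat-diag : ∀ {n} (i : Fin n) → idMat i i ≡ + 1
idMat-diag zero    = refl
idMat-diag (suc i) = idMat-diag i

idMat-off : ∀ {n} (i j : Fin n) → i ≢ j → idMat i j ≡ + 0
idMat-off zero    zero    i≢j = contradiction refl i≢j
idMat-off zero    (suc j) _   = refl
idMat-off (suc i) zero    _   = refl
idMat-off (suc i) (suc j) i≢j = idMat-off i j (i≢j ∘ cong suc)

isHermite-blockH1 : ∀ n₁ n₂ {H} → IsHermite H → IsHermite (blockH1 n₁ n₂ H)
isHermite-blockH1 n₁ n₂ {H} (lowerH , diagonalH , upperH) = lower , diagonal , upper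
  where
  H₁ = blockH1 n₁ n₂ H
  0<1 : + 0 <ℤ + 1
  0<1 = +<+ (s≤s z≤n)

  lower : ∀ i j → j < i → H₁ i j ≡ + 0
  lower i j j<i with split n₁ n₂ i | split n₁ n₂ j
  ... | left k  | left l  = trans (blockH1-↑ˡ-↑ˡ n₁ n₂ H k l) (lowerH _ _ j<i)
  ... | left k  | right l = blockH1-↑ˡ-↑ʳ n₁ n₂ H k l
  ... | right k | left l  = blockH1-↑ʳ-↑ˡ n₁ n₂ H k l
  ... | right k | right l =
    trans (blockH1-↑ʳ-↑ʳ n₁ n₂ H k l) (idMat-off k l (<⇒≢ j<i ∘ cong (n₁ ↑ʳ_) ∘ sym))

  diagonal : ∀ i → + 0 <ℤ H₁ i i
  diagonal i with split n₁ n₂ i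
  ... | left k  rewrite blockH1-↑ˡ-↑ˡ n₁ n₂ H k k = diagonalH (k ↑ˡ n₂)
  ... | right k rewrite blockH1-↑ʳ-↑ʳ n₁ n₂ H k k | idMat-diag k = 0<1

  upper : ∀ i j → i < j → (+ 0 ≤ℤ H₁ i j) × (H₁ i j <ℤ H₁ j j)
  upper i j i<j with split n₁ n₂ i | split n₁ n₂ j
  ... | left k  | left l  rewrite blockH1-↑ˡ-↑ˡ n₁ n₂ H k l | blockH1-↑ˡ-↑ˡ n₁ n₂ H l l =
    upperH _ _ i<j
  ... | left k  | right l rewrite blockH1-↑ˡ-↑ʳ n₁ n₂ H k l | blockH1-↑ʳ-↑ʳ n₁ n₂ H l l
                                | idMat-diag l =
    ℤ.≤-refl , 0<1
  ... | right k | left l  rewrite blockH1-↑ʳ-↑ˡ n₁ n₂ H k l | blockH1-↑ˡ-↑ˡ n₁ n₂ H l l =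
    ℤ.≤-refl , diagonalH (l ↑ˡ n₂)
  ... | right k | right l rewrite blockH1-↑ʳ-↑ʳ n₁ n₂ H k l | blockH1-↑ʳ-↑ʳ n₁ n₂ H l l
                                | idMat-off k l (<⇒≢ i<j ∘ cong (n₁ ↑ʳ_)) | idMat-diag l =
    ℤ.≤-refl , 0<1

generated-stack : ∀ {ℓ k m n} (M : Mat ℓ m) (A : Mat k m) (F : Mat n m) {p} →
  Generated M F p → Generated (stack M A) F p
generated-stack M A F (x , y , p≡xM+yF) = x ++ (λ _ → + 0) , y , λ j →
  trans (p≡xM+yF j) (cong (_+ℤ (y ·ᵥ F) j) (sym ([x,0]·MA≡xM j)))
  where
  [x,0]·MA≡xM : ∀ j → ((x ++ (λ _ → + 0)) ·ᵥ stack M A) j ≡ (x ·ᵥ M) j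
  [x,0]·MA≡xM j =
    trans (·ᵥ-++-stack x (λ _ → + 0) M A j)
          (trans (cong ((x ·ᵥ M) j +ℤ_) (·ᵥ-zeroˡ A j (λ _ → refl))) (ℤ.+-identityʳ _))

isBasisOf-idMat-mono : ∀ {n} {L L′ : Lattice n} →
  (∀ {p} → L p → L′ p) → IsBasisOf idMat L → IsBasisOf idMat L′
isBasisOf-idMat-mono L⊆L′ basis p =
  mk⇔ (λ _ → p , λ j → sym (·ᵥ-idMat p j)) (L⊆L′ ∘ Equivalence.from (basis p))

coprime-stack : ∀ {ℓ k m n} (M : Mat ℓ m) (A : Mat k m) (F : Mat n m) →
  Coprime M F → Coprime (stack M A) F
coprime-stack M A F (hermite , basis) =
  hermite , isBasisOf-idMat-mono (generated-stack M A F) basis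

theorem24 : (m n₁ n₂ : ℕ) (S : Mat m m) (F : Mat (n₁ + n₂) m) (H : Mat (n₁ + n₂) (n₁ + n₂)) →
    IsNonsingularSmith S →
    IsHermiteBasisOf H (Relations S F) →
    IsHermiteBasisOf (blockH1 n₁ n₂ H) (Relations (stack S (lastRows n₁ n₂ F)) F) ×
    (Coprime S F → Coprime (stack S (lastRows n₁ n₂ F)) F)
theorem24 m n₁ n₂ S F H _ (hermite , basis) =
  ( isHermite-blockH1 n₁ n₂ hermite
  , isBasisOf-⇔ (relations-stack-lastRows S F)
                (isBasisOf-freeOnLast n₁ n₂ (isHermite⇒isBlockUpper n₁ n₂ hermite) basis) )
  , coprime-stack S (lastRows n₁ n₂ F) F
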